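{- If $A$ is an h-lattice, then $\mathrm{K}(A)$ is a hemi-Nelson algebra.
   Context: An h-lattice is an algebra $\langle A,\wedge,\vee,\rightarrow,0,1\rangle$ of type $(2,2,2,0,0)$ such that $\langle A,\wedge,\vee,0,1\rangle$ is a bounded distributive lattice, $a\rightarrow a=1$ and $a\wedge(a\rightarrow b)\le b$ for all $a,b$. For an h-lattice $A$, $\mathrm{K}(A)=\{(a,b)\in A\times A: a\wedge b=0\}$ with operations $(a,b)\wedge(c,d)=(a\wedge c,b\vee d)$, $(a,b)\vee(c,d)=(a\vee c,b\wedge d)$, $\sim(a,b)=(b,a)$, $(a,b)\rightarrow(c,d)=(a\rightarrow c,a\wedge d)$, constants $0=(0,1)$, $1=(1,0)$. A Kleene algebra is a bounded distributive lattice $\langle T,\wedge,\vee,0,1\rangle$ with a unary operation $\sim$ such that $\sim\sim x=x$, $\sim(x\wedge y)=\sim x\vee\sim y$ and $(x\wedge\sim x)\wedge(y\vee\sim y)=x\wedge\sim x$. A hemi-Nelson algebra is an algebra $\langle T,\wedge,\vee,\rightarrow,\sim,0,1\rangle$ of type $(2,2,2,1,0,0)$ such that $\langle T,\wedge,\vee,\sim,0,1\rangle$ is a Kleene algebra and for all $x,y,z\in T$: (hN1) $x\rightarrow x=1$; (hN2) $x\wedge(x\rightarrow y)\le x\wedge(\sim x\vee y)$; (hN3) $\sim(x\rightarrow y)\rightarrow(x\wedge\sim y)=1$; (hN4) $(x\wedge\sim y)\rightarrow\sim(x\rightarrow y)=1$; (hN5) $(x\wedge y\wedge(x\rightarrow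 y))\rightarrow(x\wedge(x\rightarrow y))=1$; (hN6) $(x\wedge(x\rightarrow y))\rightarrow(x\wedge y\wedge(x\rightarrow y))=1$; (hN7) if $x\rightarrow y=1$, $y\rightarrow x=1$, $y\rightarrow z=1$ and $z\rightarrow y=1$ then $x\rightarrow z=1$ and $z\rightarrow x=1$; (hN8) if $x\rightarrow y=1$ and $y\rightarrow x=1$ then $(x\wedge z)\rightarrow(y\wedge z)=1$; (hN9) if $x\rightarrow y=1$ and $y\rightarrow x=1$ then $(x\vee z)\rightarrow(y\vee z)=1$; (hN10) if $x\rightarrow y=1$ and $y\rightarrow x=1$ then $(x\rightarrow z)\rightarrow(y\rightarrow z)=1$ and $(z\rightarrow x)\rightarrow(z\rightarrow y)=1$. -}

module Defs where

open import Level using (Level; _⊔_) renaming (suc to lsuc)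
open import Data.Product using (Σ; _×_; _,_; proj₁; proj₂)
open import Relation.Binary.Core using (Rel)
open import Relation.Binary.Bundles using (Setoid)
import Relation.Binary.Reasoning.Setoid as SR
open import Algebra.Core using (Op₁; Op₂)
import Algebra.Definitions as AD
import Algebra.Lattice.Structures as LS

record IsBDL {a ℓ} {A : Set a} (_≈_ : Rel A ℓ)
             (_∧_ _∨_ : Op₂ A) (⊥ ⊤ : A) : Set (a ⊔ ℓ) where
  field
    isDistributiveLattice : LS.IsDistributiveLattice _≈_ _∨_ _∧_
    ∨-identityʳ : ∀ x → (x ∨ ⊥) ≈ x
    ∧-identityʳ : ∀ x → (x ∧ ⊤) ≈ x

Leq : ∀ {a ℓ} {A : Set a} → Rel A ℓ → Op₂ A → A → A → Set ℓ
Leq _≈_ _∧_ x y = (x ∧ y) ≈ x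

record IsHLattice {a ℓ} {A : Set a} (_≈_ : Rel A ℓ)
                  (_∧_ _∨_ _⇒_ : Op₂ A) (⊥ ⊤ : A) : Set (a ⊔ ℓ) where
  field
    isBDL  : IsBDL _≈_ _∧_ _∨_ ⊥ ⊤
    ⇒-cong : AD.Congruent₂ _≈_ _⇒_
    ⇒-refl : ∀ x → (x ⇒ x) ≈ ⊤
    mp     : ∀ x y → Leq _≈_ _∧_ (x ∧ (x ⇒ y)) y

record HLattice c ℓ : Set (lsuc (c ⊔ ℓ)) where
  infix  4 _≈_
  infixr 5 _⇒_
  infixr 6 _∨_
  infixr 7 _∧_
  field
    Carrier    : Set c
    _≈_        : Rel Carrier ℓ
    _∧_        : Op₂ Carrier
    _∨_        : Op₂ Carrier
    _⇒_        : Op₂ Carrier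
    ⊥          : Carrier
    ⊤          : Carrier
    isHLattice : IsHLattice _≈_ _∧_ _∨_ _⇒_ ⊥ ⊤

record IsKleeneAlgebra {a ℓ} {T : Set a} (_≈_ : Rel T ℓ)
                       (_∧_ _∨_ : Op₂ T) (∼ : Op₁ T) (⊥ ⊤ : T)
                       : Set (a ⊔ ℓ) where
  field
    isBDL    : IsBDL _≈_ _∧_ _∨_ ⊥ ⊤
    ∼-cong   : AD.Congruent₁ _≈_ ∼
    ∼-invol  : ∀ x → ∼ (∼ x) ≈ x
    deMorgan : ∀ x y → ∼ (x ∧ y) ≈ (∼ x ∨ ∼ y)
    kleene   : ∀ x y → ((x ∧ ∼ x) ∧ (y ∨ ∼ y)) ≈ (x ∧ ∼ x)

record IsHemiNelson {a ℓ} {T : Set a} (_≈_ : Rel T ℓ)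
                    (_∧_ _∨_ _⇒_ : Op₂ T) (∼ : Op₁ T) (⊥ ⊤ : T)
                    : Set (a ⊔ ℓ) where
  _≤_ : T → T → Set ℓ
  _≤_ = Leq _≈_ _∧_
  field
    isKleeneAlgebra : IsKleeneAlgebra _≈_ _∧_ _∨_ ∼ ⊥ ⊤
    ⇒-cong : AD.Congruent₂ _≈_ _⇒_
    hN1  : ∀ x → (x ⇒ x) ≈ ⊤
    hN2  : ∀ x y → (x ∧ (x ⇒ y)) ≤ (x ∧ (∼ x ∨ y))
    hN3  : ∀ x y → (∼ (x ⇒ y) ⇒ (x ∧ ∼ y)) ≈ ⊤
    hN4  : ∀ x y → ((x ∧ ∼ y) ⇒ ∼ (x ⇒ y)) ≈ ⊤
    hN5  : ∀ x y → ((x ∧ (y ∧ (x ⇒ y))) ⇒ (x ∧ (x ⇒ y))) ≈ ⊤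
    hN6  : ∀ x y → ((x ∧ (x ⇒ y)) ⇒ (x ∧ (y ∧ (x ⇒ y)))) ≈ ⊤
    hN7  : ∀ x y z → (x ⇒ y) ≈ ⊤ → (y ⇒ x) ≈ ⊤ → (y ⇒ z) ≈ ⊤ → (z ⇒ y) ≈ ⊤
           → ((x ⇒ z) ≈ ⊤) × ((z ⇒ x) ≈ ⊤)
    hN8  : ∀ x y z → (x ⇒ y) ≈ ⊤ → (y ⇒ x) ≈ ⊤ → ((x ∧ z) ⇒ (y ∧ z)) ≈ ⊤
    hN9  : ∀ x y z → (x ⇒ y) ≈ ⊤ → (y ⇒ x) ≈ ⊤ → ((x ∨ z) ⇒ (y ∨ z)) ≈ ⊤
    hN10 : ∀ x y z → (x ⇒ y) ≈ ⊤ → (y ⇒ x) ≈ ⊤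
           → (((x ⇒ z) ⇒ (y ⇒ z)) ≈ ⊤) × (((z ⇒ x) ⇒ (z ⇒ y)) ≈ ⊤)

module K {c ℓ} (A : HLattice c ℓ) where
  open HLattice A

  Carrierᴷ : Set (c ⊔ ℓ)
  Carrierᴷ = Σ (Carrier × Carrier) (λ p → (proj₁ p ∧ proj₂ p) ≈ ⊥)

  fst snd : Carrierᴷ → Carrier
  fst p = proj₁ (proj₁ p)
  snd p = proj₂ (proj₁ p)

  _≈ᴷ_ : Rel Carrierᴷ ℓ
  p ≈ᴷ q = (fst p ≈ fst q) × (snd p ≈ snd q)

  private
    open IsHLattice isHLattice
    open IsBDL isBDL
    open LS.IsDistributiveLattice isDistributiveLattice
    S : Setoid c ℓ
    S = record { isEquivalence = isEquivalence }
    open SR S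

    zeroˡ : ∀ x → (⊥ ∧ x) ≈ ⊥
    zeroˡ x = begin
      ⊥ ∧ x          ≈⟨ ∧-cong refl (sym (trans (∨-comm ⊥ x) (∨-identityʳ x))) ⟩
      ⊥ ∧ (⊥ ∨ x)    ≈⟨ ∧-absorbs-∨ ⊥ x ⟩
      ⊥              ∎

    zeroʳ : ∀ x → (x ∧ ⊥) ≈ ⊥
    zeroʳ x = trans (∧-comm x ⊥) (zeroˡ x)

    ⊥∨⊥ : (⊥ ∨ ⊥) ≈ ⊥
    ⊥∨⊥ = ∨-identityʳ ⊥

    ∧-clo : ∀ {a b c d} → (a ∧ b) ≈ ⊥ → (c ∧ d) ≈ ⊥ → ((a ∧ c) ∧ (b ∨ d)) ≈ ⊥
    ∧-clo {a} {b} {c} {d} ab cd = begin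
      (a ∧ c) ∧ (b ∨ d)                 ≈⟨ ∧-distribˡ-∨ (a ∧ c) b d ⟩
      ((a ∧ c) ∧ b) ∨ ((a ∧ c) ∧ d)     ≈⟨ ∨-cong p q ⟩
      ⊥ ∨ ⊥                             ≈⟨ ⊥∨⊥ ⟩
      ⊥                                 ∎
      where
      p : ((a ∧ c) ∧ b) ≈ ⊥
      p = begin
        (a ∧ c) ∧ b   ≈⟨ ∧-cong (∧-comm a c) refl ⟩
        (c ∧ a) ∧ b   ≈⟨ ∧-assoc c a b ⟩
        c ∧ (a ∧ b)   ≈⟨ ∧-cong refl ab ⟩
        c ∧ ⊥         ≈⟨ zeroʳ c ⟩
        ⊥             ∎
      q : ((a ∧ c) ∧ d) ≈ ⊥
      q = begin
        (a ∧ c) ∧ d   ≈⟨ ∧-assoc a c d ⟩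
        a ∧ (c ∧ d)   ≈⟨ ∧-cong refl cd ⟩
        a ∧ ⊥         ≈⟨ zeroʳ a ⟩
        ⊥             ∎

    ∨-clo : ∀ {a b c d} → (a ∧ b) ≈ ⊥ → (c ∧ d) ≈ ⊥ → ((a ∨ c) ∧ (b ∧ d)) ≈ ⊥
    ∨-clo {a} {b} {c} {d} ab cd = begin
      (a ∨ c) ∧ (b ∧ d)                 ≈⟨ ∧-distribʳ-∨ (b ∧ d) a c ⟩
      (a ∧ (b ∧ d)) ∨ (c ∧ (b ∧ d))     ≈⟨ ∨-cong p q ⟩
      ⊥ ∨ ⊥                             ≈⟨ ⊥∨⊥ ⟩
      ⊥                                 ∎
      where
      p : (a ∧ (b ∧ d)) ≈ ⊥
      p = begin
        a ∧ (b ∧ d)   ≈⟨ sym (∧-assoc a b d) ⟩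
        (a ∧ b) ∧ d   ≈⟨ ∧-cong ab refl ⟩
        ⊥ ∧ d         ≈⟨ zeroˡ d ⟩
        ⊥             ∎
      q : (c ∧ (b ∧ d)) ≈ ⊥
      q = begin
        c ∧ (b ∧ d)   ≈⟨ ∧-cong refl (∧-comm b d) ⟩
        c ∧ (d ∧ b)   ≈⟨ sym (∧-assoc c d b) ⟩
        (c ∧ d) ∧ b   ≈⟨ ∧-cong cd refl ⟩
        ⊥ ∧ b         ≈⟨ zeroˡ b ⟩
        ⊥             ∎

    ⇒-clo : ∀ {a c d} → (c ∧ d) ≈ ⊥ → ((a ⇒ c) ∧ (a ∧ d)) ≈ ⊥
    ⇒-clo {a} {c} {d} cd = begin
      (a ⇒ c) ∧ (a ∧ d)           ≈⟨ sym (∧-assoc (a ⇒ c) a d) ⟩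
      ((a ⇒ c) ∧ a) ∧ d           ≈⟨ ∧-cong (∧-comm (a ⇒ c) a) refl ⟩
      (a ∧ (a ⇒ c)) ∧ d           ≈⟨ ∧-cong (sym (mp a c)) refl ⟩
      ((a ∧ (a ⇒ c)) ∧ c) ∧ d     ≈⟨ ∧-assoc (a ∧ (a ⇒ c)) c d ⟩
      (a ∧ (a ⇒ c)) ∧ (c ∧ d)     ≈⟨ ∧-cong refl cd ⟩
      (a ∧ (a ⇒ c)) ∧ ⊥           ≈⟨ zeroʳ (a ∧ (a ⇒ c)) ⟩
      ⊥                           ∎

  _∧ᴷ_ : Op₂ Carrierᴷ
  ((a , b) , ab) ∧ᴷ ((c , d) , cd) = ((a ∧ c) , (b ∨ d)) , ∧-clo ab cd

  _∨ᴷ_ : Op₂ Carrierᴷ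
  ((a , b) , ab) ∨ᴷ ((c , d) , cd) = ((a ∨ c) , (b ∧ d)) , ∨-clo ab cd

  ∼ᴷ : Op₁ Carrierᴷ
  ∼ᴷ ((a , b) , ab) = (b , a) , trans (∧-comm b a) ab

  _⇒ᴷ_ : Op₂ Carrierᴷ
  ((a , b) , ab) ⇒ᴷ ((c , d) , cd) = ((a ⇒ c) , (a ∧ d)) , ⇒-clo cd

  ⊥ᴷ : Carrierᴷ
  ⊥ᴷ = (⊥ , ⊤) , zeroˡ ⊤

  ⊤ᴷ : Carrierᴷ
  ⊤ᴷ = (⊤ , ⊥) , zeroʳ ⊤

{-# OPTIONS --safe #-}
module Submission where

open import Defs
open import Data.Product using (_,_; proj₂)
open import Algebra.Lattice.Bundles using (Lattice)
import Algebra.Lattice.Properties.Lattice as LatticeProperties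
import Algebra.Lattice.Structures as LS
import Relation.Binary.Lattice as R
import Relation.Binary.Reasoning.Setoid as SetoidReasoning

-- In K(A), u ⇒ v ≈ ⊤ means fst u ⇒ fst v ≈ ⊤ and fst u ∧ snd v ≈ ⊥. The
-- second condition is automatic once fst u ≈ fst v, since fst v ∧ snd v ≈ ⊥;
-- conversely, implications ⊤ in both directions force fst u ≈ fst v by modus
-- ponens. So hN3–hN10 reduce to equalities between first components, which
-- follow from congruence and from a ∧ (c ∧ (a ⇒ c)) ≈ a ∧ (a ⇒ c).

module HLatticeProperties {c ℓ} (A : HLattice c ℓ) where
  open HLattice A
  open IsHLattice isHLattice
  open IsBDL isBDL
  open LS.IsDistributiveLattice isDistributiveLattice

  lattice : Lattice c ℓ
  lattice = record { isLattice = isLattice }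

  open Lattice lattice using (setoid)
  open LatticeProperties lattice using (∨-∧-orderTheoreticLattice; ∧-idem)
  -- This order is x ≤ y ⇔ x ≈ x ∧ y, the symmetric form of Defs.Leq.
  open R.Lattice ∨-∧-orderTheoreticLattice public
    using (_≤_; x∧y≤x; y≤x∨y; ∧-greatest; antisym)
    renaming (trans to ≤-trans)
  open SetoidReasoning setoid

  ∧-zeroˡ : ∀ x → (⊥ ∧ x) ≈ ⊥
  ∧-zeroˡ x = begin
    ⊥ ∧ x        ≈⟨ ∧-cong refl (sym (trans (∨-comm ⊥ x) (∨-identityʳ x))) ⟩
    ⊥ ∧ (⊥ ∨ x)  ≈⟨ ∧-absorbs-∨ ⊥ x ⟩
    ⊥            ∎

  ≈⇒⇒≈⊤ : ∀ {x y} → x ≈ y → (x ⇒ y) ≈ ⊤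
  ≈⇒⇒≈⊤ {x} x≈y = trans (⇒-cong refl (sym x≈y)) (⇒-refl x)

  ∧-⇒-≤ : ∀ x y → (x ∧ (x ⇒ y)) ≤ y
  ∧-⇒-≤ x y = sym (mp x y)

  ⇒≈⊤⇒≤ : ∀ {x y} → (x ⇒ y) ≈ ⊤ → x ≤ y
  ⇒≈⊤⇒≤ {x} {y} x⇒y≈⊤ = ≤-trans x≤x∧[x⇒y] (∧-⇒-≤ x y)
    where
    x≤x∧[x⇒y] : x ≤ (x ∧ (x ⇒ y))
    x≤x∧[x⇒y] = ∧-greatest (sym (∧-idem x))
      (trans (sym (∧-identityʳ x)) (∧-cong refl (sym x⇒y≈⊤)))

  ∧-⇒-absorbs-∧ : ∀ x y → (x ∧ (y ∧ (x ⇒ y))) ≈ (x ∧ (x ⇒ y))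
  ∧-⇒-absorbs-∧ x y = begin
    x ∧ (y ∧ (x ⇒ y))  ≈⟨ ∧-cong refl (∧-comm y (x ⇒ y)) ⟩
    x ∧ ((x ⇒ y) ∧ y)  ≈⟨ sym (∧-assoc x (x ⇒ y) y) ⟩
    (x ∧ (x ⇒ y)) ∧ y  ≈⟨ mp x y ⟩
    x ∧ (x ⇒ y)        ∎

  ∧-⇒-≤-∧-∨ : ∀ x y z → (x ∧ (x ⇒ y)) ≤ (x ∧ (z ∨ y))
  ∧-⇒-≤-∧-∨ x y z =
    ∧-greatest (x∧y≤x x (x ⇒ y)) (≤-trans (∧-⇒-≤ x y) (y≤x∨y z y))

module KProperties {c ℓ} (A : HLattice c ℓ) where
  open HLattice A
  open IsHLattice isHLattice
  open IsBDL isBDL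
  open LS.IsDistributiveLattice isDistributiveLattice
  open HLatticeProperties A
  open K A

  isLatticeᴷ : LS.IsLattice _≈ᴷ_ _∨ᴷ_ _∧ᴷ_
  isLatticeᴷ = record
    { isEquivalence = record
        { refl  = refl , refl
        ; sym   = λ (p , q) → sym p , sym q
        ; trans = λ (p , q) (r , s) → trans p r , trans q s
        }
    ; ∨-comm     = λ x y → ∨-comm (fst x) (fst y) , ∧-comm (snd x) (snd y)
    ; ∨-assoc    = λ x y z → ∨-assoc (fst x) (fst y) (fst z) , ∧-assoc (snd x) (snd y) (snd z)
    ; ∨-cong     = λ (p , q) (r , s) → ∨-cong p r , ∧-cong q s
    ; ∧-comm     = λ x y → ∧-comm (fst x) (fst y) , ∨-comm (snd x) (snd y)
    ; ∧-assoc    = λ x y z → ∧-assoc (fst x) (fst y) (fst z) , ∨-assoc (snd x) (snd y) (snd z)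
    ; ∧-cong     = λ (p , q) (r , s) → ∧-cong p r , ∨-cong q s
    ; absorptive = (λ x y → ∨-absorbs-∧ (fst x) (fst y) , ∧-absorbs-∨ (snd x) (snd y))
                 , (λ x y → ∧-absorbs-∨ (fst x) (fst y) , ∨-absorbs-∧ (snd x) (snd y))
    }

  isBDLᴷ : IsBDL _≈ᴷ_ _∧ᴷ_ _∨ᴷ_ ⊥ᴷ ⊤ᴷ
  isBDLᴷ = record
    { isDistributiveLattice = record
        { isLattice   = isLatticeᴷ
        ; ∨-distrib-∧ =
            (λ x y z → ∨-distribˡ-∧ (fst x) (fst y) (fst z) , ∧-distribˡ-∨ (snd x) (snd y) (snd z))
          , (λ x y z → ∨-distribʳ-∧ (fst x) (fst y) (fst z) , ∧-distribʳ-∨ (snd x) (snd y) (snd z))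
        ; ∧-distrib-∨ =
            (λ x y z → ∧-distribˡ-∨ (fst x) (fst y) (fst z) , ∨-distribˡ-∧ (snd x) (snd y) (snd z))
          , (λ x y z → ∧-distribʳ-∨ (fst x) (fst y) (fst z) , ∨-distribʳ-∧ (snd x) (snd y) (snd z))
        }
    ; ∨-identityʳ = λ x → ∨-identityʳ (fst x) , ∧-identityʳ (snd x)
    ; ∧-identityʳ = λ x → ∧-identityʳ (fst x) , ∨-identityʳ (snd x)
    }

  kleeneᴷ : ∀ x y → ((x ∧ᴷ ∼ᴷ x) ∧ᴷ (y ∨ᴷ ∼ᴷ y)) ≈ᴷ (x ∧ᴷ ∼ᴷ x)
  kleeneᴷ ((a , b) , a∧b≈⊥) ((c , d) , c∧d≈⊥) =
      trans (∧-cong a∧b≈⊥ refl) (trans (∧-zeroˡ (c ∨ d)) (sym a∧b≈⊥))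
    , trans (∨-cong refl (trans (∧-comm d c) c∧d≈⊥)) (∨-identityʳ (b ∨ a))

  isKleeneAlgebraᴷ : IsKleeneAlgebra _≈ᴷ_ _∧ᴷ_ _∨ᴷ_ ∼ᴷ ⊥ᴷ ⊤ᴷ
  isKleeneAlgebraᴷ = record
    { isBDL    = isBDLᴷ
    ; ∼-cong   = λ (p , q) → q , p
    ; ∼-invol  = λ _ → refl , refl
    ; deMorgan = λ _ _ → refl , refl
    ; kleene   = kleeneᴷ
    }

  fst≈⇒⇒ᴷ≈⊤ᴷ : ∀ u v → fst u ≈ fst v → (u ⇒ᴷ v) ≈ᴷ ⊤ᴷ
  fst≈⇒⇒ᴷ≈⊤ᴷ u v u≈v = ≈⇒⇒≈⊤ u≈v , trans (∧-cong u≈v refl) (proj₂ v)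

  ⇒ᴷ≈⊤ᴷ-both⇒fst≈ : ∀ u v → (u ⇒ᴷ v) ≈ᴷ ⊤ᴷ → (v ⇒ᴷ u) ≈ᴷ ⊤ᴷ → fst u ≈ fst v
  ⇒ᴷ≈⊤ᴷ-both⇒fst≈ _ _ (u⇒v≈⊤ , _) (v⇒u≈⊤ , _) = antisym (⇒≈⊤⇒≤ u⇒v≈⊤) (⇒≈⊤⇒≤ v⇒u≈⊤)

proposition6 : ∀ {c ℓ} (A : HLattice c ℓ) →
    IsHemiNelson (K._≈ᴷ_ A) (K._∧ᴷ_ A) (K._∨ᴷ_ A) (K._⇒ᴷ_ A) (K.∼ᴷ A) (K.⊥ᴷ A) (K.⊤ᴷ A)
proposition6 A = record
  { isKleeneAlgebra = isKleeneAlgebraᴷ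
  ; ⇒-cong = λ (p , q) (r , s) → ⇒-cong p r , ∧-cong p s
  ; hN1  = λ x → ⇒-refl (fst x) , proj₂ x
  ; hN2  = λ x y → sym (∧-⇒-≤-∧-∨ (fst x) (fst y) (snd x)) , ∨-idem _
  ; hN3  = λ x y → fst≈⇒⇒ᴷ≈⊤ᴷ (∼ᴷ (x ⇒ᴷ y)) (x ∧ᴷ ∼ᴷ y) refl
  ; hN4  = λ x y → fst≈⇒⇒ᴷ≈⊤ᴷ (x ∧ᴷ ∼ᴷ y) (∼ᴷ (x ⇒ᴷ y)) refl
  ; hN5  = λ x y → fst≈⇒⇒ᴷ≈⊤ᴷ (x ∧ᴷ (y ∧ᴷ (x ⇒ᴷ y))) (x ∧ᴷ (x ⇒ᴷ y))
      (∧-⇒-absorbs-∧ (fst x) (fst y))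
  ; hN6  = λ x y → fst≈⇒⇒ᴷ≈⊤ᴷ (x ∧ᴷ (x ⇒ᴷ y)) (x ∧ᴷ (y ∧ᴷ (x ⇒ᴷ y)))
      (sym (∧-⇒-absorbs-∧ (fst x) (fst y)))
  ; hN7  = λ x y z x⇒y y⇒x y⇒z z⇒y →
      let x≈z = trans (⇒ᴷ≈⊤ᴷ-both⇒fst≈ x y x⇒y y⇒x) (⇒ᴷ≈⊤ᴷ-both⇒fst≈ y z y⇒z z⇒y)
      in fst≈⇒⇒ᴷ≈⊤ᴷ x z x≈z , fst≈⇒⇒ᴷ≈⊤ᴷ z x (sym x≈z)
  ; hN8  = λ x y z x⇒y y⇒x →
      fst≈⇒⇒ᴷ≈⊤ᴷ (x ∧ᴷ z) (y ∧ᴷ z) (∧-cong (⇒ᴷ≈⊤ᴷ-both⇒fst≈ x y x⇒y y⇒x) refl)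
  ; hN9  = λ x y z x⇒y y⇒x →
      fst≈⇒⇒ᴷ≈⊤ᴷ (x ∨ᴷ z) (y ∨ᴷ z) (∨-cong (⇒ᴷ≈⊤ᴷ-both⇒fst≈ x y x⇒y y⇒x) refl)
  ; hN10 = λ x y z x⇒y y⇒x →
      let x≈y = ⇒ᴷ≈⊤ᴷ-both⇒fst≈ x y x⇒y y⇒x
      in fst≈⇒⇒ᴷ≈⊤ᴷ (x ⇒ᴷ z) (y ⇒ᴷ z) (⇒-cong x≈y refl)
       , fst≈⇒⇒ᴷ≈⊤ᴷ (z ⇒ᴷ x) (z ⇒ᴷ y) (⇒-cong refl x≈y)
  }
  where
  open HLattice A
  open IsHLattice isHLattice
  open IsBDL isBDL
  open LS.IsDistributiveLattice isDistributiveLattice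
  open LatticeProperties (HLatticeProperties.lattice A) using (∨-idem)
  open HLatticeProperties A using (∧-⇒-≤-∧-∨; ∧-⇒-absorbs-∧)
  open KProperties A
  open K A
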